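{- Let $p_1<p_2<p_3<\cdots$ be the primes in increasing order, and for $n\ge 1$ let $P_n=p_1p_2\cdots p_n$. Let $m$ be a positive integer. If $m<P_n$, then $\overline{\varphi}(m)>\overline{\varphi}(P_n)$. If $m<P_n$ and $2m\neq P_n$, then $\mathscr{S}(m)<\mathscr{S}(P_n)$.
   Context: For a positive integer $n$, $\overline{\varphi}(n)=\prod_{p\mid n}\frac{p-1}{p}=\frac{\varphi(n)}{n}$, where $\varphi$ is Euler's totient function and the product runs over the primes $p$ dividing $n$ (empty product $=1$). The Sylvester factor is $\mathscr{S}(n)=\prod_{p\mid n,\ p\neq 2}\frac{p-1}{p-2}$, the product running over the odd primes $p$ dividing $n$, and equal to $1$ if there are none (i.e. if $n$ is a power of $2$). -}

module Defs where

open import Data.Nat using (ℕ; zero; suc; _≟_; _∸_)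
open import Data.Nat.Divisibility using (_∣_; _∣?_)
import Data.List
open import Data.Nat.Primality using (Prime; prime?)
open import Data.Integer using (+_)
open import Data.Rational using (ℚ; _/_; 1ℚ; _*_)
open import Data.List using (List; upTo; filter; foldr; length)
open import Data.Nat.ListAction using (product)
open import Relation.Nullary.Decidable using (_×-dec_; ¬?)
open import Relation.Binary.PropositionalEquality using (_≡_)
open import Data.Product using (_×_)
open import Relation.Nullary using (¬_)

-- the primes p with p ∣ n, in increasing order (for n ≥ 1; all such p ≤ n)
primeDivisors : ℕ → List ℕ
primeDivisors n = filter (λ p → prime? p ×-dec p ∣? n) (upTo (suc n))

oddPrimeDivisors : ℕ → List ℕ
oddPrimeDivisors n = filter (λ p → ¬? (p ≟ 2)) (primeDivisors n)

-- (p - 1) / p   (only applied to primes, so p ≥ 2)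
phiFactor : ℕ → ℚ
phiFactor zero    = 1ℚ
phiFactor (suc k) = + k / suc k

-- (p - 1) / (p - 2)   (only applied to odd primes, so p ≥ 3)
sylFactor : ℕ → ℚ
sylFactor (suc (suc (suc i))) = + suc (suc i) / suc i
sylFactor _                   = 1ℚ

prodℚ : List ℚ → ℚ
prodℚ = foldr _*_ 1ℚ

phiBar : ℕ → ℚ
phiBar n = prodℚ (Data.List.map phiFactor (primeDivisors n))

sylvester : ℕ → ℚ
sylvester n = prodℚ (Data.List.map sylFactor (oddPrimeDivisors n))

primeCount : ℕ → ℕ
primeCount q = length (filter prime? (upTo q))

-- q is the n-th prime p_n (1-indexed): q is prime and exactly n-1 primes are below q
IsNthPrime : ℕ → ℕ → Set
IsNthPrime n q = Prime q × primeCount q ≡ n ∸ 1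

-- product of all primes ≤ q; when q = p_n this is the primorial P_n = p_1 ⋯ p_n
primesUpToProduct : ℕ → ℕ
primesUpToProduct q = product (filter prime? (upTo (suc q)))

{-# OPTIONS --safe #-}

-- Let E be the primes dividing m that exceed q = p_n and M the primes ≤ q not dividing m; the primes
-- dividing both m and P = P_n contribute equally to both sides and cancel. As they also divide m,
-- m < P gives ∏E < ∏M, and since every prime of E exceeds every prime of M, |E| < |M|. The factor
-- (p-1)/p of φ̄ increases with p, so φ̄(P)/φ̄(m) ≤ c^|M| / c^|E| < 1 for c = (q-1)/q. For 𝒮, whose
-- factors (p-1)/(p-2) decrease with p and which ignores 2, the same count over odd primes only
-- gives |E| ≤ |M|, because 2 ∣ P costs a factor 2; this still yields 𝒮(m) < 𝒮(P) unless M has no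
-- odd prime, and then m is the odd part of P, i.e. 2m = P.

module Submission where

open import Defs
open import Level using (Level)
open import Algebra.Bundles using (CommutativeMonoid)
open import Data.Bool.Properties using (∧-zeroʳ)
open import Data.List using (List; []; _∷_; [_]; _++_; _∷ʳ_; foldr; map; filter; upTo; length)
open import Data.List.Properties using (map-id; filter-≐; filter-++; filter-reject; filter-all; upTo-∷ʳ; ++-identityʳ)
open import Data.List.Membership.Propositional using (_∈_)
open import Data.List.Membership.Propositional.Properties using (∈-upTo⁻; ∈-upTo⁺; ∈-filter⁻; ∈-filter⁺)
open import Data.List.Relation.Unary.All as All using (All; []; _∷_)
open import Data.List.Relation.Unary.All.Properties using (all-filter)
open import Data.List.Relation.Unary.AllPairs using ([]; _∷_)
open import Data.List.Relation.Unary.Any using (here; there)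
open import Data.List.Relation.Unary.Unique.Propositional using (Unique)
import Data.List.Relation.Unary.Unique.Propositional.Properties as Unique
open import Data.Nat using (ℕ; zero; suc)
import Data.Nat as ℕ
import Data.Nat.Properties as ℕ
import Data.Rational as ℚ
open import Data.Rational using () renaming (_<_ to _<ℚ_)
import Data.Rational.Properties as ℚ
open import Data.Product using (_×_; _,_; proj₁; proj₂; swap)
open import Data.Sum using (_⊎_; inj₁; inj₂)
open import Function using (_∘_; id)
open import Relation.Nullary using (yes; no; does; ¬_; ¬?; contradiction)
open import Relation.Nullary.Decidable using (decidable-stable)
open import Relation.Unary using (Pred; Decidable; _∩_)
open import Relation.Unary.Properties using (_∩?_; ∁?)
open import Relation.Binary.PropositionalEquality
  using (_≡_; _≢_; refl; sym; trans; cong; cong₂; subst; subst₂; module ≡-Reasoning)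

private variable
  a c ℓ ℓ₁ ℓ₂ : Level
  A : Set a

-- Filtered lists and their products

module _ {P : Pred A ℓ₁} {Q : Pred A ℓ₂} (P? : Decidable P) (Q? : Decidable Q) where

  filter-∩ : ∀ xs → filter (P? ∩? Q?) xs ≡ filter P? (filter Q? xs)
  filter-∩ [] = refl
  filter-∩ (x ∷ xs) with Q? x
  ... | no _ rewrite ∧-zeroʳ (does (P? x)) = filter-∩ xs
  ... | yes _ with P? x
  ...   | yes _ = cong (x ∷_) (filter-∩ xs)
  ...   | no  _ = filter-∩ xs

  filter-∩-comm : ∀ xs → filter (P? ∩? Q?) xs ≡ filter (Q? ∩? P?) xs
  filter-∩-comm = filter-≐ (P? ∩? Q?) (Q? ∩? P?) (swap , swap)

module _ (M : CommutativeMonoid c ℓ) where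
  open CommutativeMonoid M renaming (sym to ≈-sym)
  open import Algebra.Properties.CommutativeSemigroup commutativeSemigroup using (x∙yz≈y∙xz)
  open import Relation.Binary.Reasoning.Setoid setoid

  foldr-map-filter-split : ∀ (f : A → Carrier) {P : Pred A ℓ₁} {Q : Pred A ℓ₂}
    (P? : Decidable P) (Q? : Decidable Q) xs →
    foldr _∙_ ε (map f (filter P? xs)) ≈
    foldr _∙_ ε (map f (filter (Q? ∩? P?) xs)) ∙ foldr _∙_ ε (map f (filter (∁? Q? ∩? P?) xs))
  foldr-map-filter-split f P? Q? [] = ≈-sym (identityˡ ε)
  foldr-map-filter-split f P? Q? (x ∷ xs) with P? x
  ... | no _ rewrite ∧-zeroʳ (does (Q? x)) | ∧-zeroʳ (does (∁? Q? x)) =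
    foldr-map-filter-split f P? Q? xs
  ... | yes _ with Q? x
  ...   | yes _ = begin
    f x ∙ _         ≈⟨ ∙-congˡ (foldr-map-filter-split f P? Q? xs) ⟩
    f x ∙ (_ ∙ _)   ≈⟨ assoc _ _ _ ⟨
    (f x ∙ _) ∙ _   ∎
  ...   | no _ = begin
    f x ∙ _         ≈⟨ ∙-congˡ (foldr-map-filter-split f P? Q? xs) ⟩
    f x ∙ (_ ∙ _)   ≈⟨ x∙yz≈y∙xz _ _ _ ⟩
    _ ∙ (f x ∙ _)   ∎

-- Rational inequalities

module RationalBounds where
  open import Data.Rational using (ℚ; 0ℚ; 1ℚ; _*_; _≤_; _<_; _/_; toℚᵘ; positive; nonNegative)
  open import Data.Rational.Properties
  open import Data.Rational.Unnormalised using (mkℚᵘ; _≃_; *≤*; *<*)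
  import Data.Rational.Unnormalised.Properties as ℚᵘ
  open import Data.Integer using (+_)
  import Data.Integer as ℤ
  import Data.Integer.Properties as ℤ
  open import Algebra.Definitions.RawSemiring +-*-rawSemiring using (_^_)
  open ≤-Reasoning

  0≤1 : 0ℚ ≤ 1ℚ
  0≤1 = nonNegative⁻¹ 1ℚ

  *-mono-≤-nonNeg : ∀ {a b c d} → 0ℚ ≤ b → 0ℚ ≤ c → a ≤ b → c ≤ d → a * c ≤ b * d
  *-mono-≤-nonNeg {a} {b} {c} {d} 0≤b 0≤c a≤b c≤d = begin
    a * c  ≤⟨ *-monoʳ-≤-nonNeg c {{nonNegative 0≤c}} a≤b ⟩
    b * c  ≤⟨ *-monoˡ-≤-nonNeg b {{nonNegative 0≤b}} c≤d ⟩
    b * d  ∎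

  *-nonNeg : ∀ {a b} → 0ℚ ≤ a → 0ℚ ≤ b → 0ℚ ≤ a * b
  *-nonNeg {a} {b} 0≤a 0≤b =
    nonNegative⁻¹ _ {{nonNeg*nonNeg⇒nonNeg a {{nonNegative 0≤a}} b {{nonNegative 0≤b}}}}

  *-pos : ∀ {a b} → 0ℚ < a → 0ℚ < b → 0ℚ < a * b
  *-pos {a} {b} 0<a 0<b = positive⁻¹ _ {{pos*pos⇒pos a {{positive 0<a}} b {{positive 0<b}}}}

  ^-nonNeg : ∀ {x} n → 0ℚ ≤ x → 0ℚ ≤ x ^ n
  ^-nonNeg zero    _   = 0≤1
  ^-nonNeg (suc n) 0≤x = *-nonNeg 0≤x (^-nonNeg n 0≤x)

  ^-pos : ∀ {x} n → 0ℚ < x → 0ℚ < x ^ n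
  ^-pos zero    _   = positive⁻¹ 1ℚ
  ^-pos (suc n) 0<x = *-pos 0<x (^-pos n 0<x)

  1≤^ : ∀ {x} n → 1ℚ ≤ x → 1ℚ ≤ x ^ n
  1≤^ zero    _   = ≤-refl
  1≤^ (suc n) 1≤x = ≤-trans (≤-reflexive (sym (*-identityˡ 1ℚ)))
    (*-mono-≤-nonNeg (≤-trans 0≤1 1≤x) 0≤1 1≤x (1≤^ n 1≤x))

  ^-monoʳ-≤ : ∀ {x m n} → 1ℚ ≤ x → m ℕ.≤ n → x ^ m ≤ x ^ n
  ^-monoʳ-≤ {n = n} 1≤x ℕ.z≤n = 1≤^ n 1≤x
  ^-monoʳ-≤ {m = suc m} 1≤x (ℕ.s≤s m≤n) =
    *-mono-≤-nonNeg (≤-trans 0≤1 1≤x) (^-nonNeg m (≤-trans 0≤1 1≤x)) ≤-refl (^-monoʳ-≤ 1≤x m≤n)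

  ^-monoˡ-≤ : ∀ {x y} n → 0ℚ ≤ x → x ≤ y → x ^ n ≤ y ^ n
  ^-monoˡ-≤ zero    _   _   = ≤-refl
  ^-monoˡ-≤ (suc n) 0≤x x≤y =
    *-mono-≤-nonNeg (≤-trans 0≤x x≤y) (^-nonNeg n 0≤x) x≤y (^-monoˡ-≤ n 0≤x x≤y)

  ^-monoˡ-< : ∀ {x y} n → 0ℚ ≤ x → x < y → x ^ suc n < y ^ suc n
  ^-monoˡ-< {x} {y} n 0≤x x<y = begin-strict
    x * x ^ n  ≤⟨ *-monoˡ-≤-nonNeg x {{nonNegative 0≤x}} (^-monoˡ-≤ n 0≤x (<⇒≤ x<y)) ⟩
    x * y ^ n  <⟨ *-monoˡ-<-pos (y ^ n) {{positive (^-pos n (≤-<-trans 0≤x x<y))}} x<y ⟩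
    y * y ^ n  ∎

  ^-antiʳ-< : ∀ {x m n} → 0ℚ < x → x < 1ℚ → m ℕ.< n → x ^ n < x ^ m
  ^-antiʳ-< {x} {m} {suc n} 0<x x<1 (ℕ.s≤s m≤n) = begin-strict
    x * x ^ n    <⟨ *-monoˡ-<-pos (x ^ n) {{positive (^-pos n 0<x)}} x<1 ⟩
    1ℚ * x ^ n   ≡⟨ *-identityˡ (x ^ n) ⟩
    x ^ n        ≤⟨ x^n≤x^m (ℕ.m≤n⇒m<n∨m≡n m≤n) ⟩
    x ^ m        ∎
    where
    x^n≤x^m : m ℕ.< n ⊎ m ≡ n → x ^ n ≤ x ^ m
    x^n≤x^m (inj₁ m<n) = <⇒≤ (^-antiʳ-< 0<x x<1 m<n)
    x^n≤x^m (inj₂ refl) = ≤-refl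

  prodℚ-pos : ∀ (f : ℕ → ℚ) {xs} → All (λ x → 0ℚ < f x) xs → 0ℚ < prodℚ (map f xs)
  prodℚ-pos f []           = positive⁻¹ 1ℚ
  prodℚ-pos f (0<x ∷ 0<xs) = *-pos 0<x (prodℚ-pos f 0<xs)

  module _ (f : ℕ → ℚ) (f≥0 : ∀ x → 0ℚ ≤ f x) where

    prodℚ-nonNeg : ∀ xs → 0ℚ ≤ prodℚ (map f xs)
    prodℚ-nonNeg []       = 0≤1
    prodℚ-nonNeg (x ∷ xs) = *-nonNeg (f≥0 x) (prodℚ-nonNeg xs)

    prodℚ≤^-length : ∀ {c xs} → All (λ x → f x ≤ c) xs → prodℚ (map f xs) ≤ c ^ length xs
    prodℚ≤^-length []                           = ≤-refl
    prodℚ≤^-length {c} {x ∷ xs} (x≤c ∷ xs≤c) =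
      *-mono-≤-nonNeg (≤-trans (f≥0 x) x≤c) (prodℚ-nonNeg xs) x≤c (prodℚ≤^-length xs≤c)

    ^-length≤prodℚ : ∀ {c xs} → 0ℚ ≤ c → All (λ x → c ≤ f x) xs → c ^ length xs ≤ prodℚ (map f xs)
    ^-length≤prodℚ _   []                                 = ≤-refl
    ^-length≤prodℚ {xs = x ∷ xs} 0≤c (c≤x ∷ c≤xs) =
      *-mono-≤-nonNeg (f≥0 x) (^-nonNeg (length xs) 0≤c) c≤x (^-length≤prodℚ 0≤c c≤xs)

    prodℚ<prodℚ-below-1 : ∀ {c xs ys} → 0ℚ < c → c < 1ℚ →
      All (λ x → f x ≤ c) xs → All (λ y → c ≤ f y) ys → length ys ℕ.< length xs →
      prodℚ (map f xs) < prodℚ (map f ys)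
    prodℚ<prodℚ-below-1 {c} {xs} {ys} 0<c c<1 xs≤c ys≥c ys<xs = begin-strict
      prodℚ (map f xs)  ≤⟨ prodℚ≤^-length xs≤c ⟩
      c ^ length xs     <⟨ ^-antiʳ-< 0<c c<1 ys<xs ⟩
      c ^ length ys     ≤⟨ ^-length≤prodℚ (<⇒≤ 0<c) ys≥c ⟩
      prodℚ (map f ys)  ∎

    prodℚ<prodℚ-above-1 : ∀ {c d xs ys} → 1ℚ ≤ c → c < d →
      All (λ x → f x ≤ c) xs → All (λ y → d ≤ f y) ys → length xs ℕ.≤ length ys → 0 ℕ.< length ys →
      prodℚ (map f xs) < prodℚ (map f ys)
    prodℚ<prodℚ-above-1 {c} {d} {xs} {y ∷ ys} 1≤c c<d xs≤c ys≥d xs≤ys _ = begin-strict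
      prodℚ (map f xs)        ≤⟨ prodℚ≤^-length xs≤c ⟩
      c ^ length xs           ≤⟨ ^-monoʳ-≤ 1≤c xs≤ys ⟩
      c ^ length (y ∷ ys)     <⟨ ^-monoˡ-< (length ys) (≤-trans 0≤1 1≤c) c<d ⟩
      d ^ length (y ∷ ys)     ≤⟨ ^-length≤prodℚ (≤-trans 0≤1 (≤-trans 1≤c (<⇒≤ c<d))) ys≥d ⟩
      prodℚ (map f (y ∷ ys))  ∎

  toℚᵘ-+/suc : ∀ a b → toℚᵘ (+ a / suc b) ≃ mkℚᵘ (+ a) b
  toℚᵘ-+/suc a b = toℚᵘ-fromℚᵘ (mkℚᵘ (+ a) b)

  cross-≤ : ∀ a b c d → a ℕ.* suc d ℕ.≤ c ℕ.* suc b → + a / suc b ≤ + c / suc d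
  cross-≤ a b c d ad≤cb = toℚᵘ-cancel-≤
    (ℚᵘ.≤-respʳ-≃ (ℚᵘ.≃-sym (toℚᵘ-+/suc c d)) (ℚᵘ.≤-respˡ-≃ (ℚᵘ.≃-sym (toℚᵘ-+/suc a b))
      (*≤* (subst₂ ℤ._≤_ (ℤ.pos-* a (suc d)) (ℤ.pos-* c (suc b)) (ℤ.+≤+ ad≤cb)))))

  cross-< : ∀ a b c d → a ℕ.* suc d ℕ.< c ℕ.* suc b → + a / suc b < + c / suc d
  cross-< a b c d ad<cb = toℚᵘ-cancel-<
    (ℚᵘ.<-respʳ-≃ (ℚᵘ.≃-sym (toℚᵘ-+/suc c d)) (ℚᵘ.<-respˡ-≃ (ℚᵘ.≃-sym (toℚᵘ-+/suc a b))
      (*<* (subst₂ ℤ._<_ (ℤ.pos-* a (suc d)) (ℤ.pos-* c (suc b)) (ℤ.+<+ ad<cb)))))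

  phiFactor-nonNeg : ∀ p → 0ℚ ≤ phiFactor p
  phiFactor-nonNeg zero    = 0≤1
  phiFactor-nonNeg (suc k) = cross-≤ 0 0 k k ℕ.z≤n

  phiFactor-pos : ∀ {p} → 2 ℕ.≤ p → 0ℚ < phiFactor p
  phiFactor-pos {suc (suc k)} (ℕ.s≤s (ℕ.s≤s _)) = cross-< 0 0 (suc k) (suc k) (ℕ.s≤s ℕ.z≤n)

  phiFactor<1 : ∀ {p} → 1 ℕ.≤ p → phiFactor p < 1ℚ
  phiFactor<1 {suc k} _ = cross-< k k 1 0
    (subst₂ ℕ._<_ (sym (ℕ.*-identityʳ k)) (sym (ℕ.+-identityʳ (suc k))) (ℕ.n<1+n k))

  phiFactor-mono : ∀ {p p′} → 1 ℕ.≤ p → p ℕ.≤ p′ → phiFactor p ≤ phiFactor p′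
  phiFactor-mono {suc k} {suc l} _ (ℕ.s≤s k≤l) = cross-≤ k k l l
    (subst₂ ℕ._≤_ (sym (ℕ.*-suc k l)) (sym (ℕ.*-suc l k))
      (ℕ.+-mono-≤ k≤l (ℕ.≤-reflexive (ℕ.*-comm k l))))

  1≤sylFactor : ∀ p → 1ℚ ≤ sylFactor p
  1≤sylFactor 0                   = ≤-refl
  1≤sylFactor 1                   = ≤-refl
  1≤sylFactor 2                   = ≤-refl
  1≤sylFactor (suc (suc (suc i))) = cross-≤ 1 0 (suc (suc i)) i
    (subst₂ ℕ._≤_ (sym (ℕ.+-identityʳ (suc i))) (sym (ℕ.*-identityʳ (suc (suc i)))) (ℕ.n≤1+n (suc i)))

  sylFactor-pos : ∀ p → 0ℚ < sylFactor p
  sylFactor-pos p = <-≤-trans (positive⁻¹ 1ℚ) (1≤sylFactor p)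

  sylFactor-anti : ∀ {p p′} → 3 ℕ.≤ p → p ℕ.≤ p′ → sylFactor p′ ≤ sylFactor p
  sylFactor-anti {suc (suc (suc i))} {suc (suc (suc j))}
    (ℕ.s≤s (ℕ.s≤s (ℕ.s≤s _))) (ℕ.s≤s (ℕ.s≤s i+1≤j+1)) =
    cross-≤ (suc (suc j)) j (suc (suc i)) i (ℕ.+-mono-≤ i+1≤j+1 (ℕ.≤-reflexive (ℕ.*-comm (suc j) (suc i))))

  sylFactor-suc< : ∀ {p} → 3 ℕ.≤ p → sylFactor (suc p) < sylFactor p
  sylFactor-suc< {suc (suc (suc i))} (ℕ.s≤s (ℕ.s≤s (ℕ.s≤s _))) =
    cross-< (suc (suc (suc i))) (suc i) (suc (suc i)) i
      (ℕ.+-mono-<-≤ (ℕ.n<1+n (suc i)) (ℕ.≤-reflexive (ℕ.*-comm (suc (suc i)) (suc i))))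

open RationalBounds
  using ( prodℚ-pos; prodℚ<prodℚ-below-1; prodℚ<prodℚ-above-1
        ; phiFactor-nonNeg; phiFactor-pos; phiFactor<1; phiFactor-mono
        ; 1≤sylFactor; sylFactor-pos; sylFactor-anti; sylFactor-suc< )

-- ℕ's operators are opened only from here on, so that they do not clash with ℚ's above.
open import Data.Nat using (_+_; _*_; _^_; _≤_; _<_; _≤?_; s≤s; z≤n; NonZero; ≢-nonZero⁻¹)
open import Data.Nat.Divisibility using (_∣_; _∣?_; divides; divides-refl; ∣1⇒≡1; 1∣_; ∣⇒≤; n∣m*n)
open import Data.Nat.ListAction using (product)
open import Data.Nat.ListAction.Properties using (∈⇒∣product)
open import Data.Nat.Primality
  using (Prime; prime?; prime[2]; ¬prime[1]; euclidsLemma; prime⇒irreducible; prime⇒nonTrivial; productOfPrimes≢0)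
open import Algebra.Properties.CommutativeSemigroup ℕ.*-commutativeSemigroup
  using () renaming (x∙yz≈y∙xz to x*yz≡y*xz)

module _ {P : Pred ℕ ℓ₁} (P? : Decidable P) where

  filter-upTo-suc : ∀ {n N} → suc n ≤ N → filter P? (upTo (suc n)) ≡ filter (P? ∩? (_≤? n)) (upTo N)
  filter-upTo-suc {n} {zero} ()
  filter-upTo-suc {n} {suc N} (s≤s n≤N) with ℕ.m≤n⇒m<n∨m≡n n≤N
  ... | inj₂ refl = begin
    filter P? (upTo (suc n))
      ≡⟨ cong (filter P?) (filter-all (_≤? n) (All.tabulate (ℕ.≤-pred ∘ ∈-upTo⁻))) ⟨
    filter P? (filter (_≤? n) (upTo (suc n)))
      ≡⟨ filter-∩ P? (_≤? n) (upTo (suc n)) ⟨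
    filter (P? ∩? (_≤? n)) (upTo (suc n))
      ∎
    where open ≡-Reasoning
  ... | inj₁ n<N = trans (filter-upTo-suc n<N) (sym (begin
    filter P≤n? (upTo (suc N))                   ≡⟨ cong (filter P≤n?) (upTo-∷ʳ N) ⟨
    filter P≤n? (upTo N ∷ʳ N)                    ≡⟨ filter-++ P≤n? (upTo N) [ N ] ⟩
    filter P≤n? (upTo N) ++ filter P≤n? [ N ]    ≡⟨ cong (filter P≤n? (upTo N) ++_)
                                                         (filter-reject P≤n? (ℕ.<⇒≱ n<N ∘ proj₂)) ⟩
    filter P≤n? (upTo N) ++ []                   ≡⟨ ++-identityʳ _ ⟩
    filter P≤n? (upTo N)                         ∎))
    where
    open ≡-Reasoning
    P≤n? : Decidable (P ∩ (_≤ n))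
    P≤n? = P? ∩? (_≤? n)

module _ {P : Pred ℕ ℓ₁} {Q : Pred ℕ ℓ₂} (P? : Decidable P) (Q? : Decidable Q) where

  product-filter-split : ∀ xs →
    product (filter P? xs) ≡ product (filter (Q? ∩? P?) xs) * product (filter (∁? Q? ∩? P?) xs)
  product-filter-split xs = begin
    product (filter P? xs)
      ≡⟨ cong product (map-id (filter P? xs)) ⟨
    product (map id (filter P? xs))
      ≡⟨ foldr-map-filter-split ℕ.*-1-commutativeMonoid id P? Q? xs ⟩
    product (map id (filter (Q? ∩? P?) xs)) * product (map id (filter (∁? Q? ∩? P?) xs))
      ≡⟨ cong₂ _*_ (cong product (map-id (filter (Q? ∩? P?) xs))) (cong product (map-id (filter (∁? Q? ∩? P?) xs))) ⟩
    product (filter (Q? ∩? P?) xs) * product (filter (∁? Q? ∩? P?) xs)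
      ∎
    where open ≡-Reasoning

  prodℚ-filter-split : ∀ f xs →
    prodℚ (map f (filter P? xs)) ≡
    prodℚ (map f (filter (Q? ∩? P?) xs)) ℚ.* prodℚ (map f (filter (∁? Q? ∩? P?) xs))
  prodℚ-filter-split f = foldr-map-filter-split ℚ.*-1-commutativeMonoid f P? Q?

module VennDecomposition
  {S : Pred ℕ ℓ₁} {R : Pred ℕ ℓ₂} (S? : Decidable S) (R? : Decidable R) (xs : List ℕ) where

  common onlyS onlyR : List ℕ
  common = filter (R? ∩? S?) xs
  onlyS  = filter (∁? R? ∩? S?) xs
  onlyR  = filter (∁? S? ∩? R?) xs

  product-S : product (filter S? xs) ≡ product common * product onlyS
  product-S = product-filter-split S? R? xs

  product-R : product (filter R? xs) ≡ product common * product onlyR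
  product-R = trans (product-filter-split R? S? xs)
    (cong (λ ys → product ys * product onlyR) (filter-∩-comm S? R? xs))

  prodℚ-S : ∀ f → prodℚ (map f (filter S? xs)) ≡ prodℚ (map f common) ℚ.* prodℚ (map f onlyS)
  prodℚ-S f = prodℚ-filter-split S? R? f xs

  prodℚ-R : ∀ f → prodℚ (map f (filter R? xs)) ≡ prodℚ (map f common) ℚ.* prodℚ (map f onlyR)
  prodℚ-R f = trans (prodℚ-filter-split R? S? f xs)
    (cong (λ ys → prodℚ (map f ys) ℚ.* prodℚ (map f onlyR)) (filter-∩-comm S? R? xs))

  product-S≡product-R : product onlyS ≡ 1 → product onlyR ≡ 1 →
    product (filter S? xs) ≡ product (filter R? xs)
  product-S≡product-R onlyS≡1 onlyR≡1 = begin
    product (filter S? xs)          ≡⟨ product-S ⟩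
    product common * product onlyS  ≡⟨ cong (product common *_) (trans onlyS≡1 (sym onlyR≡1)) ⟩
    product common * product onlyR  ≡⟨ product-R ⟨
    product (filter R? xs)          ∎
    where open ≡-Reasoning

  product-onlyS<product-onlyR : ∀ {m k} → product (filter S? xs) ≤ m → m < k * product (filter R? xs) →
    product onlyS < k * product onlyR
  product-onlyS<product-onlyR {m} {k} S≤m m<kR = ℕ.*-cancelˡ-< (product common) _ _ (begin-strict
    product common * product onlyS     ≡⟨ product-S ⟨
    product (filter S? xs)             ≤⟨ S≤m ⟩
    m                                  <⟨ m<kR ⟩
    k * product (filter R? xs)         ≡⟨ cong (k *_) product-R ⟩
    k * (product common * product onlyR) ≡⟨ x*yz≡y*xz k (product common) (product onlyR) ⟩
    product common * (k * product onlyR) ∎)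
    where open ℕ.≤-Reasoning

-- Primes and products of primes

prime⇒≥2 : ∀ {p} → Prime p → 2 ≤ p
prime⇒≥2 {p} pp = ℕ.nonTrivial⇒n>1 p {{prime⇒nonTrivial pp}}

prime⇒≥1 : ∀ {p} → Prime p → 1 ≤ p
prime⇒≥1 = ℕ.<⇒≤ ∘ prime⇒≥2

prime∣product⇒∈ : ∀ {p xs} → Prime p → All Prime xs → p ∣ product xs → p ∈ xs
prime∣product⇒∈ pp [] p∣1 = contradiction (subst Prime (∣1⇒≡1 p∣1) pp) ¬prime[1]
prime∣product⇒∈ {xs = x ∷ xs} pp (px ∷ pxs) p∣x*xs with euclidsLemma x (product xs) pp p∣x*xs
... | inj₂ p∣xs = there (prime∣product⇒∈ pp pxs p∣xs)
... | inj₁ p∣x with prime⇒irreducible px p∣x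
...   | inj₁ refl = contradiction pp ¬prime[1]
...   | inj₂ p≡x  = here p≡x

product-∣ : ∀ {m xs} → All Prime xs → Unique xs → All (_∣ m) xs → product xs ∣ m
product-∣ [] [] [] = 1∣ _
product-∣ {xs = x ∷ xs} (px ∷ pxs) (x∉xs ∷ uxs) (x∣m ∷ xs∣m) with product-∣ pxs uxs xs∣m
... | divides-refl k with euclidsLemma k (product xs) px x∣m
...   | inj₂ x∣xs = contradiction refl (All.lookup x∉xs (prime∣product⇒∈ px pxs x∣xs))
...   | inj₁ (divides-refl j) = subst (x * product xs ∣_) (sym (ℕ.*-assoc j x (product xs))) (n∣m*n j)

product-filter-∣ : ∀ {X : Pred ℕ ℓ₁} (X? : Decidable X) {m xs} → Unique xs →
  (∀ {x} → X x → Prime x × x ∣ m) → product (filter X? xs) ∣ m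
product-filter-∣ X? {xs = xs} xs-unique X⇒prime∣m =
  product-∣ (All.map (proj₁ ∘ X⇒prime∣m) (all-filter X? xs)) (Unique.filter⁺ X? xs-unique)
            (All.map (proj₂ ∘ X⇒prime∣m) (all-filter X? xs))

primeDivisors-upTo : ∀ {n N} .{{_ : NonZero n}} → suc n ≤ N →
  primeDivisors n ≡ filter (prime? ∩? (_∣? n)) (upTo N)
primeDivisors-upTo {n} {N} n<N = trans (filter-upTo-suc (prime? ∩? (_∣? n)) n<N)
  (filter-≐ _ (prime? ∩? (_∣? n)) (proj₁ , λ p∣n → p∣n , ∣⇒≤ (proj₂ p∣n)) (upTo N))

primesUpToProduct-upTo : ∀ {q N} → suc q ≤ N →
  primesUpToProduct q ≡ product (filter (prime? ∩? (_≤? q)) (upTo N))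
primesUpToProduct-upTo q<N = cong product (filter-upTo-suc prime? q<N)

prime∣primesUpToProduct⇒≤ : ∀ {p q} → Prime p → p ∣ primesUpToProduct q → p ≤ q
prime∣primesUpToProduct⇒≤ {p} {q} pp p∣P = ℕ.≤-pred (∈-upTo⁻ (proj₁ (∈-filter⁻ prime? p∈primes)))
  where
  p∈primes : p ∈ filter prime? (upTo (suc q))
  p∈primes = prime∣product⇒∈ pp (all-filter prime? (upTo (suc q))) p∣P

≤⇒prime∣primesUpToProduct : ∀ {p q} → Prime p → p ≤ q → p ∣ primesUpToProduct q
≤⇒prime∣primesUpToProduct pp p≤q = ∈⇒∣product (∈-filter⁺ prime? (∈-upTo⁺ (s≤s p≤q)) pp)

primeDivisors-primesUpToProduct : ∀ {q N} → suc (primesUpToProduct q) ≤ N →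
  primeDivisors (primesUpToProduct q) ≡ filter (prime? ∩? (_≤? q)) (upTo N)
primeDivisors-primesUpToProduct {q} {N} P<N = trans
  (primeDivisors-upTo {{productOfPrimes≢0 (all-filter prime? (upTo (suc q)))}} P<N)
  (filter-≐ _ _ ((λ (pp , p∣P) → pp , prime∣primesUpToProduct⇒≤ pp p∣P)
              , (λ (pp , p≤q) → pp , ≤⇒prime∣primesUpToProduct pp p≤q)) (upTo N))

^-length≤product : ∀ {c xs} → All (c ≤_) xs → c ^ length xs ≤ product xs
^-length≤product []           = ℕ.≤-refl
^-length≤product (c≤x ∷ c≤xs) = ℕ.*-mono-≤ c≤x (^-length≤product c≤xs)

product≤^-length : ∀ {c xs} → All (_≤ c) xs → product xs ≤ c ^ length xs
product≤^-length []           = ℕ.≤-refl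
product≤^-length (x≤c ∷ xs≤c) = ℕ.*-mono-≤ x≤c (product≤^-length xs≤c)

length≡0⇒product≡1 : ∀ xs → length xs ≡ 0 → product xs ≡ 1
length≡0⇒product≡1 [] _ = refl

product<⇒length< : ∀ {q k xs ys} → All (q <_) xs → All (_≤ q) ys →
  product xs < suc q ^ k * product ys → length xs < k + length ys
product<⇒length< {q} {k} {xs} {ys} xs>q ys≤q xs<ys = ℕ.≰⇒> λ k+ys≤xs → ℕ.<⇒≱ xs<ys (begin
  suc q ^ k * product ys          ≤⟨ ℕ.*-monoʳ-≤ (suc q ^ k) (product≤^-length ys≤q) ⟩
  suc q ^ k * q ^ length ys       ≤⟨ ℕ.*-monoʳ-≤ (suc q ^ k) (ℕ.^-monoˡ-≤ (length ys) (ℕ.n≤1+n q)) ⟩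
  suc q ^ k * suc q ^ length ys   ≡⟨ ℕ.^-distribˡ-+-* (suc q) k (length ys) ⟨
  suc q ^ (k + length ys)         ≤⟨ ℕ.^-monoʳ-≤ (suc q) k+ys≤xs ⟩
  suc q ^ length xs               ≤⟨ ^-length≤product xs>q ⟩
  product xs                      ∎)
  where open ℕ.≤-Reasoning

m∣n<2m⇒n≡m : ∀ {m n} .{{_ : NonZero n}} → m ∣ n → n < 2 * m → n ≡ m
m∣n<2m⇒n≡m {n = n} (divides 0 n≡0) _ = contradiction n≡0 (≢-nonZero⁻¹ n)
m∣n<2m⇒n≡m {m} (divides 1 n≡1*m) _ = trans n≡1*m (ℕ.*-identityˡ m)
m∣n<2m⇒n≡m {m} (divides (suc (suc k)) refl) n<2m =
  contradiction n<2m (ℕ.≤⇒≯ (ℕ.*-monoˡ-≤ m {2} {suc (suc k)} (s≤s (s≤s z≤n))))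

-- Comparison with the primorial

module PrimorialComparison {q m : ℕ} (pq : Prime q) .{{_ : NonZero m}} (m<P : m < primesUpToProduct q) where

  P : ℕ
  P = primesUpToProduct q

  N : ℕ
  N = suc (m + P + q)

  -- Every set of primes considered below is a filter of this one list, so that the sets can be
  -- cut into Venn regions whose products are compared.
  U : List ℕ
  U = upTo N

  S? : Decidable (Prime ∩ (_∣ m))
  S? = prime? ∩? (_∣? m)

  R? : Decidable (Prime ∩ (_≤ q))
  R? = prime? ∩? (_≤? q)

  ≢2? : Decidable (_≢ 2)
  ≢2? p = ¬? (p ℕ.≟ 2)

  m<N : suc m ≤ N
  m<N = s≤s (ℕ.≤-trans (ℕ.m≤m+n m P) (ℕ.m≤m+n (m + P) q))

  P<N : suc P ≤ N
  P<N = s≤s (ℕ.≤-trans (ℕ.m≤n+m P m) (ℕ.m≤m+n (m + P) q))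

  q<N : suc q ≤ N
  q<N = s≤s (ℕ.m≤n+m q (m + P))

  primeDivisors-m : primeDivisors m ≡ filter S? U
  primeDivisors-m = primeDivisors-upTo m<N

  primeDivisors-P : primeDivisors P ≡ filter R? U
  primeDivisors-P = primeDivisors-primesUpToProduct P<N

  P≡product-R : P ≡ product (filter R? U)
  P≡product-R = primesUpToProduct-upTo q<N

  product-S∣m : product (filter S? U) ∣ m
  product-S∣m = product-filter-∣ S? (Unique.upTo⁺ N) id

  module V = VennDecomposition S? R? U

  onlyS>q : All (q <_) V.onlyS
  onlyS>q = All.map (λ (¬R , pp , _) → ℕ.≰⇒> (λ p≤q → ¬R (pp , p≤q))) (all-filter (∁? R? ∩? S?) U)

  onlyR⊆R : All (Prime ∩ (_≤ q)) V.onlyR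
  onlyR⊆R = All.map proj₂ (all-filter (∁? S? ∩? R?) U)

  length-onlyS<length-onlyR : length V.onlyS < length V.onlyR
  length-onlyS<length-onlyR = product<⇒length< {k = 0} onlyS>q (All.map proj₂ onlyR⊆R)
    (V.product-onlyS<product-onlyR {k = 1} (∣⇒≤ product-S∣m)
      (subst (m <_) (trans P≡product-R (sym (ℕ.*-identityˡ _))) m<P))

  prodℚ-onlyR<prodℚ-onlyS : prodℚ (map phiFactor V.onlyR) ℚ.< prodℚ (map phiFactor V.onlyS)
  prodℚ-onlyR<prodℚ-onlyS = prodℚ<prodℚ-below-1 phiFactor phiFactor-nonNeg
    (phiFactor-pos (prime⇒≥2 pq)) (phiFactor<1 (prime⇒≥1 pq))
    (All.map (λ (pp , p≤q) → phiFactor-mono (prime⇒≥1 pp) p≤q) onlyR⊆R)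
    (All.map (phiFactor-mono (prime⇒≥1 pq) ∘ ℕ.<⇒≤) onlyS>q)
    length-onlyS<length-onlyR

  phiBar-< : phiBar P ℚ.< phiBar m
  phiBar-< = begin-strict
    phiBar P                                 ≡⟨ cong (prodℚ ∘ map phiFactor) primeDivisors-P ⟩
    prodℚ (map phiFactor (filter R? U))      ≡⟨ V.prodℚ-R phiFactor ⟩
    Π V.common ℚ.* Π V.onlyR                 <⟨ ℚ.*-monoʳ-<-pos (Π V.common) {{ℚ.positive common-pos}}
                                                  prodℚ-onlyR<prodℚ-onlyS ⟩
    Π V.common ℚ.* Π V.onlyS                 ≡⟨ V.prodℚ-S phiFactor ⟨
    prodℚ (map phiFactor (filter S? U))      ≡⟨ cong (prodℚ ∘ map phiFactor) primeDivisors-m ⟨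
    phiBar m                                 ∎
    where
    open ℚ.≤-Reasoning
    Π : List ℕ → ℚ.ℚ
    Π xs = prodℚ (map phiFactor xs)
    common-pos : ℚ.0ℚ ℚ.< Π V.common
    common-pos = prodℚ-pos phiFactor
      (All.map (phiFactor-pos ∘ prime⇒≥2 ∘ proj₁ ∘ proj₂) (all-filter (R? ∩? S?) U))

  -- 𝒮 ignores the prime 2, so the second comparison runs over odd primes only; as 2 ∣ P, the
  -- hypothesis m < P then reads m < 2 · ∏R′.
  S′? : Decidable ((_≢ 2) ∩ Prime ∩ (_∣ m))
  S′? = ≢2? ∩? S?

  R′? : Decidable ((_≢ 2) ∩ Prime ∩ (_≤ q))
  R′? = ≢2? ∩? R?

  module V′ = VennDecomposition S′? R′? U

  filter-R∖R′≡[2] : filter (∁? ≢2? ∩? R?) U ≡ [ 2 ]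
  filter-R∖R′≡[2] = begin
    filter (∁? ≢2? ∩? R?) U         ≡⟨ filter-≐ (∁? ≢2? ∩? R?) ((ℕ._≟ 2) ∩? (_≤? 2)) (to , from) U ⟩
    filter ((ℕ._≟ 2) ∩? (_≤? 2)) U  ≡⟨ filter-upTo-suc (ℕ._≟ 2) (ℕ.≤-trans (s≤s (prime⇒≥2 pq)) q<N) ⟨
    filter (ℕ._≟ 2) (upTo 3)        ≡⟨⟩
    [ 2 ]                           ∎
    where
    open ≡-Reasoning
    to : ∀ {p} → ¬ ¬ p ≡ 2 × Prime p × p ≤ q → p ≡ 2 × p ≤ 2
    to {p} (¬p≢2 , _) with decidable-stable (p ℕ.≟ 2) ¬p≢2
    ... | refl = refl , ℕ.≤-refl
    from : ∀ {p} → p ≡ 2 × p ≤ 2 → ¬ ¬ p ≡ 2 × Prime p × p ≤ q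
    from (refl , _) = (λ 2≢2 → 2≢2 refl) , prime[2] , prime⇒≥2 pq

  P≡2*product-R′ : P ≡ 2 * product (filter R′? U)
  P≡2*product-R′ = begin
    P                                                          ≡⟨ P≡product-R ⟩
    product (filter R? U)                                      ≡⟨ product-filter-split R? ≢2? U ⟩
    product (filter R′? U) * product (filter (∁? ≢2? ∩? R?) U)
                                                               ≡⟨ cong ((product (filter R′? U) *_) ∘ product) filter-R∖R′≡[2] ⟩
    product (filter R′? U) * 2                                 ≡⟨ ℕ.*-comm (product (filter R′? U)) 2 ⟩
    2 * product (filter R′? U)                                 ∎
    where open ≡-Reasoning

  product-S′∣m : product (filter S′? U) ∣ m
  product-S′∣m = product-filter-∣ S′? (Unique.upTo⁺ N) proj₂

  sylvester-m : sylvester m ≡ prodℚ (map sylFactor (filter S′? U))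
  sylvester-m = cong (prodℚ ∘ map sylFactor)
    (trans (cong (filter ≢2?) primeDivisors-m) (sym (filter-∩ ≢2? S? U)))

  sylvester-P : sylvester P ≡ prodℚ (map sylFactor (filter R′? U))
  sylvester-P = cong (prodℚ ∘ map sylFactor)
    (trans (cong (filter ≢2?) primeDivisors-P) (sym (filter-∩ ≢2? R? U)))

  onlyS′>q : All (q <_) V′.onlyS
  onlyS′>q = All.map (λ (¬R′ , p≢2 , pp , _) → ℕ.≰⇒> (λ p≤q → ¬R′ (p≢2 , pp , p≤q)))
    (all-filter (∁? R′? ∩? S′?) U)

  onlyR′-bounds : All (λ p → 3 ≤ p × p ≤ q) V′.onlyR
  onlyR′-bounds = All.map (λ (_ , p≢2 , pp , p≤q) → ℕ.≤∧≢⇒< (prime⇒≥2 pp) (p≢2 ∘ sym) , p≤q)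
    (all-filter (∁? S′? ∩? R′?) U)

  length-onlyS′≤length-onlyR′ : length V′.onlyS ≤ length V′.onlyR
  length-onlyS′≤length-onlyR′ = ℕ.≤-pred (product<⇒length< {k = 1} onlyS′>q (All.map proj₂ onlyR′-bounds)
    (ℕ.<-≤-trans
      (V′.product-onlyS<product-onlyR {k = 2} (∣⇒≤ product-S′∣m) (subst (m <_) P≡2*product-R′ m<P))
      (ℕ.*-monoˡ-≤ (product V′.onlyR) 2≤suc-q^1)))
    where
    2≤suc-q^1 : 2 ≤ suc q ^ 1
    2≤suc-q^1 = ℕ.≤-trans (ℕ.m≤n⇒m≤1+n (prime⇒≥2 pq)) (ℕ.≤-reflexive (sym (ℕ.*-identityʳ (suc q))))

  2*m≡P-if-no-onlyR′ : length V′.onlyR ≡ 0 → 2 * m ≡ P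
  2*m≡P-if-no-onlyR′ onlyR′-empty = begin
    2 * m                              ≡⟨ cong (2 *_) m≡S′ ⟩
    2 * product (filter S′? U)         ≡⟨ cong (2 *_) S′≡R′ ⟩
    2 * product (filter R′? U)         ≡⟨ P≡2*product-R′ ⟨
    P                                  ∎
    where
    open ≡-Reasoning
    onlyS′-empty : length V′.onlyS ≡ 0
    onlyS′-empty = ℕ.n≤0⇒n≡0 (subst (length V′.onlyS ≤_) onlyR′-empty length-onlyS′≤length-onlyR′)
    S′≡R′ : product (filter S′? U) ≡ product (filter R′? U)
    S′≡R′ = V′.product-S≡product-R (length≡0⇒product≡1 V′.onlyS onlyS′-empty)
                                   (length≡0⇒product≡1 V′.onlyR onlyR′-empty)
    m≡S′ : m ≡ product (filter S′? U)
    m≡S′ = m∣n<2m⇒n≡m product-S′∣m (subst (m <_) (trans P≡2*product-R′ (cong (2 *_) (sym S′≡R′))) m<P)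

  3≤q-if-onlyR′-nonempty : length V′.onlyR ≢ 0 → 3 ≤ q
  3≤q-if-onlyR′-nonempty = bounds-of-nonempty onlyR′-bounds
    where
    bounds-of-nonempty : ∀ {xs} → All (λ p → 3 ≤ p × p ≤ q) xs → length xs ≢ 0 → 3 ≤ q
    bounds-of-nonempty []                  nonempty = contradiction refl nonempty
    bounds-of-nonempty ((3≤p , p≤q) ∷ _)   _        = ℕ.≤-trans 3≤p p≤q

  prodℚ-onlyS′<prodℚ-onlyR′ : length V′.onlyR ≢ 0 →
    prodℚ (map sylFactor V′.onlyS) ℚ.< prodℚ (map sylFactor V′.onlyR)
  prodℚ-onlyS′<prodℚ-onlyR′ onlyR′-nonempty = prodℚ<prodℚ-above-1 sylFactor (ℚ.<⇒≤ ∘ sylFactor-pos)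
    (1≤sylFactor (suc q)) (sylFactor-suc< (3≤q-if-onlyR′-nonempty onlyR′-nonempty))
    (All.map (sylFactor-anti (s≤s (prime⇒≥2 pq))) onlyS′>q)
    (All.map (λ (3≤p , p≤q) → sylFactor-anti 3≤p p≤q) onlyR′-bounds)
    length-onlyS′≤length-onlyR′ (ℕ.n≢0⇒n>0 onlyR′-nonempty)

  sylvester-< : 2 * m ≢ P → sylvester m ℚ.< sylvester P
  sylvester-< 2m≢P with length V′.onlyR ℕ.≟ 0
  ... | yes onlyR′-empty    = contradiction (2*m≡P-if-no-onlyR′ onlyR′-empty) 2m≢P
  ... | no  onlyR′-nonempty = begin-strict
    sylvester m                              ≡⟨ sylvester-m ⟩
    prodℚ (map sylFactor (filter S′? U))     ≡⟨ V′.prodℚ-S sylFactor ⟩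
    Π V′.common ℚ.* Π V′.onlyS               <⟨ ℚ.*-monoʳ-<-pos (Π V′.common) {{ℚ.positive common-pos}}
                                                  (prodℚ-onlyS′<prodℚ-onlyR′ onlyR′-nonempty) ⟩
    Π V′.common ℚ.* Π V′.onlyR               ≡⟨ V′.prodℚ-R sylFactor ⟨
    prodℚ (map sylFactor (filter R′? U))     ≡⟨ sylvester-P ⟨
    sylvester P                              ∎
    where
    open ℚ.≤-Reasoning
    Π : List ℕ → ℚ.ℚ
    Π xs = prodℚ (map sylFactor xs)
    common-pos : ℚ.0ℚ ℚ.< Π V′.common
    common-pos = prodℚ-pos sylFactor (All.tabulate {xs = V′.common} (λ {p} _ → sylFactor-pos p))

mainTheorem3 : (n q m : ℕ) → 1 ≤ n → IsNthPrime n q → 1 ≤ m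
    → (m < primesUpToProduct q → phiBar (primesUpToProduct q) <ℚ phiBar m)
    × (m < primesUpToProduct q → 2 * m ≢ primesUpToProduct q
       → sylvester m <ℚ sylvester (primesUpToProduct q))
mainTheorem3 _ q m _ (q-prime , _) 1≤m =
  (λ m<P → PrimorialComparison.phiBar-< q-prime m<P) ,
  (λ m<P → PrimorialComparison.sylvester-< q-prime m<P)
  where instance
  m≢0 : NonZero m
  m≢0 = ℕ.>-nonZero 1≤m
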